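{- Let $M$ be a decomposable $2\times$MDS code in $D(m,n)$ whose characteristic function decomposes as $\chi_M(\tilde z_1,\tilde z_2)\equiv\chi_{M_1}(\tilde z_1)+\chi_{M_2}(\tilde z_2)+\sigma\pmod 2$, where the coordinates of $D(m,n)$ are split into two disjoint nonempty collections $\tilde z_1$ (consisting of $m_1$ Sh-coordinates and $n_1$ K-coordinates) and $\tilde z_2$ (consisting of $m_2=m-m_1$ Sh-coordinates and $n_2=n-n_1$ K-coordinates), $M_i$ is a $2\times$MDS code in $D(m_i,n_i)$, and $\sigma\in\{0,1\}$. Suppose that for each $i\in\{1,2\}$, both $M_i$ and its complement have $N_i$ components. Then $M$, as well as its complement, has $2N_1N_2$ components.
   Context: The Shrikhande graph $\mathrm{Sh}$ is the Cayley graph of $\mathbb{Z}_4^2$ with connecting set $\{(0,1),(1,0),(1,1),(0,3),(3,0),(3,3)\}$. $K=K_4$ is the complete graph on $4$ vertices (Cayley graph of $\mathbb{Z}_2^2$ with connecting set $\{(0,1),(1,0),(1,1)\}$). $D(m,n)=\mathrm{Sh}^m\times K^n$ is the Cartesian product: vertices are tuples of $m$ elements of $\mathbb{Z}_4^2$ (Sh-coordinates) and $n$ elements of $\mathbb{Z}_2^2$ (K-coordinates), adjacent iff they differ in exactly one coordinate and the differing entries are adjacent in the corresponding factor. A Shrikhande line is the set of $16$ vertices obtained by fixing all coordinates except one Sh-coordinate; a $K$-line is the set of $4$ vertices obtained by fixing all coordinates except one K-coordinate. A $2\times$MDS code in $D(m,n)$ is a vertex set $M$ such that the intersection of $M$ with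 every Shrikhande line consists of $8$ vertices forming (in the copy of $\mathrm{Sh}$ induced by the line) the union of two disjoint independent $4$-sets, and every $K$-line contains exactly $2$ elements of $M$. Components of a vertex set are the connected components of the subgraph it induces. A $2\times$MDS code is decomposable if its characteristic function is the modulo-$2$ sum of two $\{0,1\}$-valued functions of disjoint nonempty collections of coordinates. -}

module Defs where

open import Data.Nat using (ℕ; zero; suc; _+_; _∸_; _≥_)
open import Data.Nat.DivMod using (_%_)
open import Data.Fin using (Fin; toℕ)
open import Data.Bool using (Bool; true; false; if_then_else_; _∨_)
open import Data.List using (List; map; allFin; cartesianProduct)
open import Data.Nat.ListAction using (sum)
open import Data.Vec using (Vec; lookup; tabulate; _[_]≔_)
open import Data.Product using (_×_; _,_; Σ; ∃; ∃-syntax)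
open import Data.Sum using (_⊎_; inj₁; inj₂)
open import Relation.Nullary using (¬_)
open import Relation.Binary.PropositionalEquality using (_≡_)
open import Relation.Binary.Construct.Closure.ReflexiveTransitive using (Star)
open import Function.Bundles using (_↔_; Inverse)
open Inverse using (to)

-- ℤ₄² (vertices of the Shrikhande graph) and ℤ₂² (vertices of K₄)
Z4² : Set
Z4² = Fin 4 × Fin 4

Z2² : Set
Z2² = Fin 2 × Fin 2

sub4 : Fin 4 → Fin 4 → ℕ
sub4 a b = (toℕ a + 4 ∸ toℕ b) % 4

data ShConn : ℕ → ℕ → Set where
  c01 : ShConn 0 1
  c10 : ShConn 1 0
  c11 : ShConn 1 1
  c03 : ShConn 0 3
  c30 : ShConn 3 0
  c33 : ShConn 3 3

ShAdj : Z4² → Z4² → Set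
ShAdj (a₁ , a₂) (b₁ , b₂) = ShConn (sub4 a₁ b₁) (sub4 a₂ b₂)

-- adjacency in K₄ = Cayley graph of ℤ₂² with connecting set of all
-- nonzero elements, i.e. distinct vertices are adjacent
KAdj : Z2² → Z2² → Set
KAdj u v = ¬ (u ≡ v)

-- D(m,n) = Sh^m × K^n

V : ℕ → ℕ → Set
V m n = Vec Z4² m × Vec Z2² n

Adj : ∀ {m n} → V m n → V m n → Set
Adj {m} {n} (x , y) (x' , y') =
    (Σ (Fin m) λ i → ShAdj (lookup x i) (lookup x' i)
                   × x' ≡ (x [ i ]≔ lookup x' i) × y' ≡ y)
  ⊎ (Σ (Fin n) λ j → KAdj (lookup y j) (lookup y' j)
                   × y' ≡ (y [ j ]≔ lookup y' j) × x' ≡ x)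

elemsSh : List Z4²
elemsSh = cartesianProduct (allFin 4) (allFin 4)

elemsK : List Z2²
elemsK = cartesianProduct (allFin 2) (allFin 2)

count : {A : Set} → List A → (A → Bool) → ℕ
count xs P = sum (map (λ a → if P a then 1 else 0) xs)

IndependentSh : (Z4² → Bool) → Set
IndependentSh A = ∀ u v → A u ≡ true → A v ≡ true → ¬ ShAdj u v

TwoIndep4 : (Z4² → Bool) → Set
TwoIndep4 P =
  count elemsSh P ≡ 8 ×
  Σ (Z4² → Bool) λ A → Σ (Z4² → Bool) λ B →
      IndependentSh A × IndependentSh B
    × count elemsSh A ≡ 4 × count elemsSh B ≡ 4
    × (∀ u → ¬ (A u ≡ true × B u ≡ true))
    × (∀ u → P u ≡ (A u ∨ B u))

shLine : ∀ {m n} → V m n → Fin m → Z4² → V m n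
shLine (x , y) i a = (x [ i ]≔ a) , y

kLine : ∀ {m n} → V m n → Fin n → Z2² → V m n
kLine (x , y) j b = x , (y [ j ]≔ b)

Is2MDS : ∀ m n → (V m n → Bool) → Set
Is2MDS m n χ =
    (∀ (v : V m n) (i : Fin m) → TwoIndep4 (λ a → χ (shLine v i a)))
  × (∀ (v : V m n) (j : Fin n) → count elemsK (λ b → χ (kLine v j b)) ≡ 2)

InducedEdge : ∀ {m n} → (V m n → Bool) → V m n → V m n → Set
InducedEdge χ u v = χ u ≡ true × χ v ≡ true × Adj u v

Connected : ∀ {m n} → (V m n → Bool) → V m n → V m n → Set
Connected χ = Star (InducedEdge χ)

HasComponents : ∀ {m n} → (V m n → Bool) → ℕ → Set
HasComponents {m} {n} χ N =
  Σ ((v : V m n) → χ v ≡ true → Fin N) λ c →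
      (∀ k → ∃[ v ] ∃[ p ] c v p ≡ k)
    × (∀ u v (pu : χ u ≡ true) (pv : χ v ≡ true) →
          (c u pu ≡ c v pv → Connected χ u v)
        × (Connected χ u v → c u pu ≡ c v pv))

-- given bijections  Fin m₁ ⊎ Fin m₂ ↔ Fin m  and  Fin n₁ ⊎ Fin n₂ ↔ Fin n
-- (i.e. a partition of the Sh- and K-coordinates), the two sub-tuples
part₁ : ∀ {m n m₁ m₂ n₁ n₂} →
        ((Fin m₁ ⊎ Fin m₂) ↔ Fin m) → ((Fin n₁ ⊎ Fin n₂) ↔ Fin n) →
        V m n → V m₁ n₁
part₁ α β (x , y) =
  tabulate (λ i → lookup x (to α (inj₁ i))) ,
  tabulate (λ j → lookup y (to β (inj₁ j)))

part₂ : ∀ {m n m₁ m₂ n₁ n₂} →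
        ((Fin m₁ ⊎ Fin m₂) ↔ Fin m) → ((Fin n₁ ⊎ Fin n₂) ↔ Fin n) →
        V m n → V m₂ n₂
part₂ α β (x , y) =
  tabulate (λ i → lookup x (to α (inj₂ i))) ,
  tabulate (λ j → lookup y (to β (inj₂ j)))

-- Write T = χ₁ ⊕ χ₂ ⊕ σ on the product of the two factor graphs.  Along an edge of
-- the first factor χ₂ is unchanged, so inside a level set of T such an edge joins two
-- vertices of the same χ₁-colour; likewise for the second factor.  Hence paths in a
-- level set of T are exactly pairs of paths that are monochromatic in each factor, and
-- a component is determined by the χ₁-colour of its vertices together with a
-- component of χ₁ or of its complement and a component of χ₂ or of its complement
-- (the χ₂-colour being forced by T).  This gives 2 N₁ N₂ components for either level
-- set.

module Submission where

open import Defs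
open import Level using (0ℓ)
open import Data.Nat using (ℕ; _+_; _*_; _≥_)
open import Data.Fin using (Fin; _≟_)
open import Data.Fin.Properties using (*↔×; 2↔Bool)
open import Data.Bool using (Bool; true; false; not; _xor_)
open import Data.Bool.Properties using (not-injective; not-distribʳ-xor; xor-comm)
open import Data.Sum using (_⊎_; inj₁; inj₂; [_,_])
open import Data.Sum.Properties using (inj₁-injective; inj₂-injective)
open import Data.Product using (_×_; _,_; Σ; ∃-syntax; proj₁; proj₂)
open import Data.Product.Properties using (,-injectiveˡ; ,-injectiveʳ)
open import Data.Product.Function.NonDependent.Propositional using (_×-↔_)
open import Data.Vec using (Vec; lookup; tabulate; _[_]≔_)
open import Data.Vec.Properties
  using (lookup∘tabulate; tabulate∘lookup; tabulate-cong; lookup∘update; lookup∘update′)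
open import Function using (_∘_)
open import Function.Bundles using (_↔_; Inverse; Injection; mk↔ₛ′)
open import Function.Properties.Inverse using (↔-sym; ↔-trans; ↔-refl; ↔⇒↣)
open import Relation.Binary.Core using (Rel)
open import Relation.Binary.Construct.Closure.ReflexiveTransitive
  using (Star; ε; _◅_; _◅◅_; fold; gmap; map; return)
open import Relation.Binary.PropositionalEquality
  using (_≡_; _≢_; refl; sym; trans; cong; cong₂; subst₂)
open import Relation.Nullary using (Dec; yes; no)

xor-cancelˡ : ∀ x {y z} → x xor y ≡ x xor z → y ≡ z
xor-cancelˡ false eq = eq
xor-cancelˡ true  eq = not-injective eq

xor-cancelʳ : ∀ {x y} z → x xor z ≡ y xor z → x ≡ y
xor-cancelʳ {x} {y} z eq = xor-cancelˡ z (trans (xor-comm z x) (trans eq (xor-comm y z)))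

xor-complement : ∀ x t → (x xor not (x xor t)) xor t ≡ true
xor-complement false false = refl
xor-complement false true  = refl
xor-complement true  false = refl
xor-complement true  true  = refl

-- Components of induced subgraphs

module _ {W : Set} where

  Induced : Rel W 0ℓ → (W → Bool) → Rel W 0ℓ
  Induced E χ u v = χ u ≡ true × χ v ≡ true × E u v

  -- HasComponents χ N is Components Adj χ (Fin N); labels in an arbitrary type let
  -- them be built as tuples and encoded into Fin N only at the end.
  Components : Rel W 0ℓ → (W → Bool) → Set → Set
  Components E χ A =
    Σ ((v : W) → χ v ≡ true → A) λ c →
        (∀ k → ∃[ v ] ∃[ p ] c v p ≡ k)
      × (∀ u v (pu : χ u ≡ true) (pv : χ v ≡ true) →
            (c u pu ≡ c v pv → Star (Induced E χ) u v)
          × (Star (Induced E χ) u v → c u pu ≡ c v pv))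

  component-cong : ∀ {E χ A} (C : Components E χ A) {u v}
                   (pu : χ u ≡ true) (pv : χ v ≡ true) → u ≡ v → proj₁ C u pu ≡ proj₁ C v pv
  component-cong (_ , _ , exact) pu pv refl = proj₂ (exact _ _ pu pv) ε

  Star-invariant : ∀ {B : Set} {R : Rel W 0ℓ} (f : W → B) →
                   (∀ {u v} → R u v → f u ≡ f v) → ∀ {u v} → Star R u v → f u ≡ f v
  Star-invariant f f-resp = fold (λ u v → f u ≡ f v) (λ r eq → trans (f-resp r) eq) refl

  relabel : ∀ {E χ A B} → A ↔ B → Components E χ A → Components E χ B
  relabel g (c , onto , exact) =
    (λ v p → to (c v p)) ,
    (λ k → let v , p , eq = onto (from k) in v , p , trans (cong to eq) (strictlyInverseˡ k)) ,
    λ u v pu pv → proj₁ (exact u v pu pv) ∘ Injection.injective (↔⇒↣ g) ,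
                  cong to ∘ proj₂ (exact u v pu pv)
    where open Inverse g

module _ {W W' : Set} {E : Rel W 0ℓ} {E' : Rel W' 0ℓ} (f : W ↔ W')
         (to-edge : ∀ {u v} → E u v → E' (Inverse.to f u) (Inverse.to f v))
         (from-edge : ∀ {u v} → E' u v → E (Inverse.from f u) (Inverse.from f v)) where
  open Inverse f

  transport : ∀ {χ χ' A} → (∀ v → χ v ≡ χ' (to v)) → Components E' χ' A → Components E χ A
  transport {χ} {χ'} χ≡ C@(c , onto , exact) =
    (λ v p → c (to v) (push p)) ,
    (λ k → let w , p , eq = onto k
           in from w , pull p , trans (component-cong C _ p (strictlyInverseˡ w)) eq) ,
    λ u v pu pv →
      (λ eq → subst₂ (Star (Induced E χ)) (strictlyInverseʳ u) (strictlyInverseʳ v)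
                (gmap from pull-edge (proj₁ (exact _ _ (push pu) (push pv)) eq))) ,
      proj₂ (exact _ _ (push pu) (push pv)) ∘ gmap to push-edge
    where
    push : ∀ {v} → χ v ≡ true → χ' (to v) ≡ true
    push {v} p = trans (sym (χ≡ v)) p

    pull : ∀ {w} → χ' w ≡ true → χ (from w) ≡ true
    pull {w} p = trans (χ≡ (from w)) (trans (cong χ' (strictlyInverseˡ w)) p)

    push-edge : ∀ {u v} → Induced E χ u v → Induced E' χ' (to u) (to v)
    push-edge (pu , pv , e) = push pu , push pv , to-edge e

    pull-edge : ∀ {u v} → Induced E' χ' u v → Induced E χ (from u) (from v)
    pull-edge (pu , pv , e) = pull pu , pull pv , from-edge e

module _ {W : Set} where

  SameColour : Rel W 0ℓ → (W → Bool) → Rel W 0ℓ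
  SameColour E χ u v = χ u ≡ χ v × E u v

  -- The components of χ and of its complement together, each colour class labelled by A.
  record ColourComponents (E : Rel W 0ℓ) (χ : W → Bool) (A : Set) : Set where
    field
      label           : W → A
      label⇒connected : ∀ {u v} → χ u ≡ χ v → label u ≡ label v → Star (SameColour E χ) u v
      connected⇒label : ∀ {u v} → Star (SameColour E χ) u v → label u ≡ label v
      label-onto      : ∀ b k → ∃[ v ] χ v ≡ b × label v ≡ k

  module _ {E : Rel W 0ℓ} {χ ψ : W → Bool} {b : Bool}
           (ψ⇒χ : ∀ {z} → ψ z ≡ true → χ z ≡ b) (χ⇒ψ : ∀ {z} → χ z ≡ b → ψ z ≡ true) where

    induced⇒sameColour : ∀ {u v} → Star (Induced E ψ) u v → Star (SameColour E χ) u v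
    induced⇒sameColour = map λ (pu , pv , e) → trans (ψ⇒χ pu) (sym (ψ⇒χ pv)) , e

    sameColour⇒induced : ∀ {u v} → χ u ≡ b → Star (SameColour E χ) u v → Star (Induced E ψ) u v
    sameColour⇒induced pu ε                  = ε
    sameColour⇒induced pu ((same , e) ◅ s) = (χ⇒ψ pu , χ⇒ψ pv , e) ◅ sameColour⇒induced pv s
      where pv = trans (sym same) pu

  colourComponents : ∀ {E χ A} → Components E χ A → Components E (not ∘ χ) A →
                     ColourComponents E χ A
  colourComponents {E} {χ} {A} (c⁺ , onto⁺ , exact⁺) C⁻@(c⁻ , onto⁻ , exact⁻) = record
    { label           = label
    ; label⇒connected = λ {u} {v} same eq →
        proj₁ (exactAt (χ u) refl (sym same)) (trans eq (sym (labelAt-label v (sym same))))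
    ; connected⇒label = λ {u} {v} s →
        let same = Star-invariant χ proj₁ s
        in trans (proj₂ (exactAt (χ u) refl (sym same)) s) (labelAt-label v (sym same))
    ; label-onto      = onto
    }
    where
    labelAt : ∀ v b → χ v ≡ b → A
    labelAt v true  p = c⁺ v p
    labelAt v false p = c⁻ v (cong not p)

    label : W → A
    label v = labelAt v (χ v) refl

    labelAt-label : ∀ v {b} (p : χ v ≡ b) → labelAt v b p ≡ label v
    labelAt-label v refl = refl

    exactAt : ∀ b {u v} (pu : χ u ≡ b) (pv : χ v ≡ b) →
              (labelAt u b pu ≡ labelAt v b pv → Star (SameColour E χ) u v)
            × (Star (SameColour E χ) u v → labelAt u b pu ≡ labelAt v b pv)
    exactAt true pu pv =
      let ⇒ , ⇐ = exact⁺ _ _ pu pv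
      in induced⇒sameColour (λ p → p) (λ p → p) ∘ ⇒ , ⇐ ∘ sameColour⇒induced (λ p → p) (λ p → p) pu
    exactAt false pu pv =
      let ⇒ , ⇐ = exact⁻ _ _ (cong not pu) (cong not pv)
      in induced⇒sameColour (not-injective {y = false}) (cong not) ∘ ⇒ ,
         ⇐ ∘ sameColour⇒induced (not-injective {y = false}) (cong not) pu

    onto : ∀ b k → ∃[ v ] χ v ≡ b × label v ≡ k
    onto true k = let v , p , eq = onto⁺ k in v , p , trans (sym (labelAt-label v p)) eq
    onto false k =
      let v , p , eq = onto⁻ k
          q = not-injective {y = false} p
      in v , q , trans (sym (labelAt-label v q)) (trans (component-cong C⁻ _ p refl) eq)

-- Level sets of χ₁ ⊕ χ₂ in a Cartesian product of graphs

module _ {W₁ W₂ : Set} where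

  _□_ : Rel W₁ 0ℓ → Rel W₂ 0ℓ → Rel (W₁ × W₂) 0ℓ
  (E₁ □ E₂) (a , b) (a' , b') = (E₁ a a' × b ≡ b') ⊎ (a ≡ a' × E₂ b b')

  _⊕_ : (W₁ → Bool) → (W₂ → Bool) → W₁ × W₂ → Bool
  (χ₁ ⊕ χ₂) (a , b) = χ₁ a xor χ₂ b

  module _ {A₁ A₂ : Set} {E₁ : Rel W₁ 0ℓ} {E₂ : Rel W₂ 0ℓ} {χ₁ : W₁ → Bool} {χ₂ : W₂ → Bool}
           (C₁ : ColourComponents E₁ χ₁ A₁) (C₂ : ColourComponents E₂ χ₂ A₂) (τ : Bool) where
    private
      module C₁ = ColourComponents C₁
      module C₂ = ColourComponents C₂

      T : W₁ × W₂ → Bool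
      T w = (χ₁ ⊕ χ₂) w xor τ

      Path : Rel (W₁ × W₂) 0ℓ
      Path = Star (Induced (E₁ □ E₂) T)

      label : W₁ × W₂ → (Bool × A₁) × A₂
      label (a , b) = (χ₁ a , C₁.label a) , C₂.label b

      colour₂-forced : ∀ {a a' b b'} → T (a , b) ≡ true → T (a' , b') ≡ true →
                       χ₁ a ≡ χ₁ a' → χ₂ b ≡ χ₂ b'
      colour₂-forced {a} {b' = b'} p p' same =
        xor-cancelˡ (χ₁ a) (trans (xor-cancelʳ τ (trans p (sym p'))) (cong (_xor χ₂ b') (sym same)))

      colour₁-forced : ∀ {a a' b b'} → T (a , b) ≡ true → T (a' , b') ≡ true →
                       χ₂ b ≡ χ₂ b' → χ₁ a ≡ χ₁ a'
      colour₁-forced {a' = a'} {b} p p' same =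
        xor-cancelʳ (χ₂ b) (trans (xor-cancelʳ τ (trans p (sym p'))) (cong (χ₁ a' xor_) (sym same)))

      lift₁ : ∀ {a a'} b → T (a , b) ≡ true → Star (SameColour E₁ χ₁) a a' → Path (a , b) (a' , b)
      lift₁ b p ε                  = ε
      lift₁ b p ((same , e) ◅ s) = (p , p' , inj₁ (e , refl)) ◅ lift₁ b p' s
        where p' = trans (cong (λ x → (x xor χ₂ b) xor τ) (sym same)) p

      lift₂ : ∀ a {b b'} → T (a , b) ≡ true → Star (SameColour E₂ χ₂) b b' → Path (a , b) (a , b')
      lift₂ a p ε                  = ε
      lift₂ a p ((same , e) ◅ s) = (p , p' , inj₂ (refl , e)) ◅ lift₂ a p' s
        where p' = trans (cong (λ x → (χ₁ a xor x) xor τ) (sym same)) p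

      edge⇒label : ∀ {w w'} → Induced (E₁ □ E₂) T w w' → label w ≡ label w'
      edge⇒label (p , p' , inj₁ (e , refl)) =
        let same = colour₁-forced p p' refl
        in cong (_, _) (cong₂ _,_ same (C₁.connected⇒label (return (same , e))))
      edge⇒label (p , p' , inj₂ (refl , e)) =
        cong (_ ,_) (C₂.connected⇒label (return (colour₂-forced p p' refl , e)))

      label⇒path : ∀ {w w'} → T w ≡ true → T w' ≡ true → label w ≡ label w' → Path w w'
      label⇒path {a , b} {a' , b'} p p' eq =
        let same₁ = ,-injectiveˡ (,-injectiveˡ eq)
            same₂ = colour₂-forced p p' same₁
            q = trans (cong (λ x → (x xor χ₂ b) xor τ) (sym same₁)) p
        in lift₁ b p (C₁.label⇒connected same₁ (,-injectiveʳ (,-injectiveˡ eq)))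
           ◅◅ lift₂ a' q (C₂.label⇒connected same₂ (,-injectiveʳ eq))

      onto : ∀ k → ∃[ w ] T w ≡ true × label w ≡ k
      onto ((c , k₁) , k₂) =
        let a , χa , la = C₁.label-onto c k₁
            b , χb , lb = C₂.label-onto (not (c xor τ)) k₂
        in (a , b) ,
           trans (cong₂ (λ x y → (x xor y) xor τ) χa χb) (xor-complement c τ) ,
           cong₂ _,_ (cong₂ _,_ χa la) lb

    □-components : Components (E₁ □ E₂) (λ w → (χ₁ ⊕ χ₂) w xor τ) ((Bool × A₁) × A₂)
    □-components =
      (λ w _ → label w) , onto ,
      λ _ _ p p' → label⇒path p p' , Star-invariant label edge⇒label

-- Vectors differing in one coordinate, and splitting the coordinates

module _ {A : Set} where

  lookup-ext : ∀ {n} {xs ys : Vec A n} → (∀ i → lookup xs i ≡ lookup ys i) → xs ≡ ys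
  lookup-ext {xs = xs} {ys} eq =
    trans (sym (tabulate∘lookup xs)) (trans (tabulate-cong eq) (tabulate∘lookup ys))

  DiffersAt : ∀ {n} → Fin n → Vec A n → Vec A n → Set
  DiffersAt i x x' = x' ≡ x [ i ]≔ lookup x' i

  differsAt⇒agreesOff : ∀ {n} {i : Fin n} {x x'} → DiffersAt i x x' →
                        ∀ j → j ≢ i → lookup x' j ≡ lookup x j
  differsAt⇒agreesOff {x = x} d j j≢i =
    trans (cong (λ y → lookup y j) d) (lookup∘update′ j≢i x _)

  agreesOff⇒differsAt : ∀ {n} {i : Fin n} {x x'} →
                        (∀ j → j ≢ i → lookup x' j ≡ lookup x j) → DiffersAt i x x'
  agreesOff⇒differsAt {i = i} {x} {x'} agree = lookup-ext λ j → at j (i ≟ j)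
    where
    at : ∀ j → Dec (i ≡ j) → lookup x' j ≡ lookup (x [ i ]≔ lookup x' i) j
    at j (yes refl) = sym (lookup∘update i x (lookup x' i))
    at j (no i≢j)   = trans (agree j (i≢j ∘ sym)) (sym (lookup∘update′ (i≢j ∘ sym) x _))

  Step : ∀ {n} → Rel A 0ℓ → Rel (Vec A n) 0ℓ
  Step R x x' = ∃[ i ] R (lookup x i) (lookup x' i) × DiffersAt i x x'

  restrict : ∀ {k n} → (Fin k → Fin n) → Vec A n → Vec A k
  restrict g x = tabulate (lookup x ∘ g)

  restrict-step : ∀ {k l n} {g : Fin k → Fin n} {h : Fin l → Fin n} {R : Rel A 0ℓ} {x x' i} s →
                  g s ≡ i → (∀ {j} → g j ≡ i → j ≡ s) → (∀ j → h j ≢ i) →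
                  R (lookup x i) (lookup x' i) → DiffersAt i x x' →
                  Step R (restrict g x) (restrict g x') × restrict h x ≡ restrict h x'
  restrict-step {g = g} {R = R} {x} {x'} {i} s gs≡i hits-only-s misses r d =
    (s , subst₂ R (sym (at x)) (sym (at x')) r ,
         agreesOff⇒differsAt λ j j≢s →
           trans (lookup∘tabulate _ j)
             (trans (differsAt⇒agreesOff d (g j) (j≢s ∘ hits-only-s))
                    (sym (lookup∘tabulate _ j)))) ,
    tabulate-cong λ j → sym (differsAt⇒agreesOff d _ (misses j))
    where
    at : ∀ y → lookup (restrict g y) s ≡ lookup y i
    at y = trans (lookup∘tabulate _ s) (cong (lookup y) gs≡i)

module Splitting {A : Set} {a b c : ℕ} (γ : (Fin a ⊎ Fin b) ↔ Fin c) where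
  open Inverse γ

  split₁ : Vec A c → Vec A a
  split₁ = restrict (to ∘ inj₁)

  split₂ : Vec A c → Vec A b
  split₂ = restrict (to ∘ inj₂)

  merge : Vec A a → Vec A b → Vec A c
  merge x₁ x₂ = tabulate ([ lookup x₁ , lookup x₂ ] ∘ from)

  lookup-merge : ∀ x₁ x₂ s → lookup (merge x₁ x₂) (to s) ≡ [ lookup x₁ , lookup x₂ ] s
  lookup-merge x₁ x₂ s =
    trans (lookup∘tabulate _ (to s)) (cong [ lookup x₁ , lookup x₂ ] (strictlyInverseʳ s))

  split₁-merge : ∀ x₁ x₂ → split₁ (merge x₁ x₂) ≡ x₁
  split₁-merge x₁ x₂ = lookup-ext λ i → trans (lookup∘tabulate _ i) (lookup-merge x₁ x₂ (inj₁ i))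

  split₂-merge : ∀ x₁ x₂ → split₂ (merge x₁ x₂) ≡ x₂
  split₂-merge x₁ x₂ = lookup-ext λ i → trans (lookup∘tabulate _ i) (lookup-merge x₁ x₂ (inj₂ i))

  merge-split : ∀ x → merge (split₁ x) (split₂ x) ≡ x
  merge-split x = lookup-ext λ j →
    trans (lookup∘tabulate _ j)
          (trans (lookup-splits (from j)) (cong (lookup x) (strictlyInverseˡ j)))
    where
    lookup-splits : ∀ s → [ lookup (split₁ x) , lookup (split₂ x) ] s ≡ lookup x (to s)
    lookup-splits (inj₁ i) = lookup∘tabulate _ i
    lookup-splits (inj₂ i) = lookup∘tabulate _ i

  preimage : ∀ {i s t} → from i ≡ s → to t ≡ i → t ≡ s
  preimage eq e = trans (sym (inverseʳ (sym e))) eq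

  step-split : ∀ {R : Rel A 0ℓ} {x x'} → Step R x x' →
               (Step R □ Step R) (split₁ x , split₂ x) (split₁ x' , split₂ x')
  step-split {R} (i , r , d) with from i in eq
  ... | inj₁ i₁ = inj₁ (restrict-step {R = R} i₁ (inverseˡ (sym eq))
                          (inj₁-injective ∘ preimage eq) (λ j → inj₂≢ ∘ preimage eq) r d)
    where inj₂≢ : ∀ {j} → inj₂ j ≢ inj₁ i₁
          inj₂≢ ()
  ... | inj₂ i₂ =
    let step , agree = restrict-step {R = R} i₂ (inverseˡ (sym eq))
                         (inj₂-injective ∘ preimage eq) (λ j → inj₁≢ ∘ preimage eq) r d
    in inj₂ (agree , step)
    where inj₁≢ : ∀ {j} → inj₁ j ≢ inj₂ i₂
          inj₁≢ ()

  merge-differsAt : ∀ {x₁ x₁' x₂ x₂'} s →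
                    (∀ t → t ≢ s → [ lookup x₁' , lookup x₂' ] t ≡ [ lookup x₁ , lookup x₂ ] t) →
                    DiffersAt (to s) (merge x₁ x₂) (merge x₁' x₂')
  merge-differsAt s agree = agreesOff⇒differsAt λ j j≢ →
    trans (lookup∘tabulate _ j)
      (trans (agree (from j) (λ e → j≢ (trans (sym (strictlyInverseˡ j)) (cong to e))))
             (sym (lookup∘tabulate _ j)))

  merge-step₁ : ∀ {R : Rel A 0ℓ} {x₁ x₁'} x₂ → Step R x₁ x₁' → Step R (merge x₁ x₂) (merge x₁' x₂)
  merge-step₁ {R} {x₁} {x₁'} x₂ (i , r , d) =
    to (inj₁ i) ,
    subst₂ R (sym (lookup-merge x₁ x₂ (inj₁ i))) (sym (lookup-merge x₁' x₂ (inj₁ i))) r ,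
    merge-differsAt {x₁} {x₁'} {x₂} {x₂} (inj₁ i) agree
    where
    agree : ∀ t → t ≢ inj₁ i → [ lookup x₁' , lookup x₂ ] t ≡ [ lookup x₁ , lookup x₂ ] t
    agree (inj₁ j) j≢i = differsAt⇒agreesOff d j (j≢i ∘ cong inj₁)
    agree (inj₂ j) _   = refl

  merge-step₂ : ∀ {R : Rel A 0ℓ} x₁ {x₂ x₂'} → Step R x₂ x₂' → Step R (merge x₁ x₂) (merge x₁ x₂')
  merge-step₂ {R} x₁ {x₂} {x₂'} (i , r , d) =
    to (inj₂ i) ,
    subst₂ R (sym (lookup-merge x₁ x₂ (inj₂ i))) (sym (lookup-merge x₁ x₂' (inj₂ i))) r ,
    merge-differsAt {x₁} {x₁} {x₂} {x₂'} (inj₂ i) agree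
    where
    agree : ∀ t → t ≢ inj₂ i → [ lookup x₁ , lookup x₂' ] t ≡ [ lookup x₁ , lookup x₂ ] t
    agree (inj₁ j) _   = refl
    agree (inj₂ j) j≢i = differsAt⇒agreesOff d j (j≢i ∘ cong inj₂)

-- D(m,n) as the Cartesian product D(m₁,n₁) □ D(m₂,n₂)

module _ {m n m₁ m₂ n₁ n₂ : ℕ}
         (α : (Fin m₁ ⊎ Fin m₂) ↔ Fin m) (β : (Fin n₁ ⊎ Fin n₂) ↔ Fin n) where
  private
    module Sh = Splitting {Z4²} α
    module K  = Splitting {Z2²} β

  splitting : V m n ↔ (V m₁ n₁ × V m₂ n₂)
  splitting = mk↔ₛ′ (λ v → part₁ α β v , part₂ α β v) mergeD split-merge merge-split
    where
    mergeD : V m₁ n₁ × V m₂ n₂ → V m n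
    mergeD ((x₁ , y₁) , (x₂ , y₂)) = Sh.merge x₁ x₂ , K.merge y₁ y₂

    split-merge : ∀ w → (part₁ α β (mergeD w) , part₂ α β (mergeD w)) ≡ w
    split-merge ((x₁ , y₁) , (x₂ , y₂)) =
      cong₂ _,_ (cong₂ _,_ (Sh.split₁-merge x₁ x₂) (K.split₁-merge y₁ y₂))
                (cong₂ _,_ (Sh.split₂-merge x₁ x₂) (K.split₂-merge y₁ y₂))

    merge-split : ∀ v → mergeD (part₁ α β v , part₂ α β v) ≡ v
    merge-split (x , y) = cong₂ _,_ (Sh.merge-split x) (K.merge-split y)

  Adj-split : ∀ {u v} → Adj u v → (Adj □ Adj) (Inverse.to splitting u) (Inverse.to splitting v)
  Adj-split {x , y} (inj₁ (i , r , d , refl)) with Sh.step-split {R = ShAdj} (i , r , d)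
  ... | inj₁ ((i₁ , r₁ , d₁) , eq) = inj₁ (inj₁ (i₁ , r₁ , d₁ , refl) , cong (_, K.split₂ y) eq)
  ... | inj₂ (eq , (i₂ , r₂ , d₂)) = inj₂ (cong (_, K.split₁ y) eq , inj₁ (i₂ , r₂ , d₂ , refl))
  Adj-split {x , y} (inj₂ (j , r , d , refl)) with K.step-split {R = KAdj} (j , r , d)
  ... | inj₁ ((j₁ , r₁ , d₁) , eq) = inj₁ (inj₂ (j₁ , r₁ , d₁ , refl) , cong (Sh.split₂ x ,_) eq)
  ... | inj₂ (eq , (j₂ , r₂ , d₂)) = inj₂ (cong (Sh.split₁ x ,_) eq , inj₂ (j₂ , r₂ , d₂ , refl))

  Adj-merge : ∀ {w w'} → (Adj □ Adj) w w' →
              Adj (Inverse.from splitting w) (Inverse.from splitting w')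
  Adj-merge {(_ , y₁) , (x₂ , _)} (inj₁ (inj₁ (i , r , d , refl) , refl)) =
    let i' , r' , d' = Sh.merge-step₁ {R = ShAdj} x₂ (i , r , d) in inj₁ (i' , r' , d' , refl)
  Adj-merge {(x₁ , _) , (_ , y₂)} (inj₁ (inj₂ (j , r , d , refl) , refl)) =
    let j' , r' , d' = K.merge-step₁ {R = KAdj} y₂ (j , r , d) in inj₂ (j' , r' , d' , refl)
  Adj-merge {(x₁ , _) , (_ , y₂)} (inj₂ (refl , inj₁ (i , r , d , refl))) =
    let i' , r' , d' = Sh.merge-step₂ {R = ShAdj} x₁ (i , r , d) in inj₁ (i' , r' , d' , refl)
  Adj-merge {(_ , y₁) , (x₂ , _)} (inj₂ (refl , inj₂ (j , r , d , refl))) =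
    let j' , r' , d' = K.merge-step₂ {R = KAdj} y₁ (j , r , d) in inj₂ (j' , r' , d' , refl)

labelCode : ∀ {N₁ N₂} → ((Bool × Fin N₁) × Fin N₂) ↔ Fin (2 * N₁ * N₂)
labelCode = ↔-sym (↔-trans *↔× (↔-trans *↔× (2↔Bool ×-↔ ↔-refl) ×-↔ ↔-refl))

lemma3 : ∀ {m n m₁ m₂ n₁ n₂ : ℕ}
    (α : (Fin m₁ ⊎ Fin m₂) ↔ Fin m) (β : (Fin n₁ ⊎ Fin n₂) ↔ Fin n) →
    m₁ + n₁ ≥ 1 → m₂ + n₂ ≥ 1 →
    (χM : V m n → Bool) (χ₁ : V m₁ n₁ → Bool) (χ₂ : V m₂ n₂ → Bool) (σ : Bool) →
    Is2MDS m n χM → Is2MDS m₁ n₁ χ₁ → Is2MDS m₂ n₂ χ₂ →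
    (∀ v → χM v ≡ (χ₁ (part₁ α β v) xor χ₂ (part₂ α β v)) xor σ) →
    (N₁ N₂ : ℕ) →
    HasComponents χ₁ N₁ → HasComponents (λ v → not (χ₁ v)) N₁ →
    HasComponents χ₂ N₂ → HasComponents (λ v → not (χ₂ v)) N₂ →
    HasComponents χM (2 * N₁ * N₂) × HasComponents (λ v → not (χM v)) (2 * N₁ * N₂)
lemma3 α β _ _ χM χ₁ χ₂ σ _ _ _ χM≡ N₁ N₂ C₁ C₁ᶜ C₂ C₂ᶜ =
  components χM≡ ,
  components {τ = not σ} λ v →
    trans (cong not (χM≡ v)) (not-distribʳ-xor (χ₁ (part₁ α β v) xor χ₂ (part₂ α β v)) σ)
  where
  components : ∀ {ψ τ} → (∀ v → ψ v ≡ (χ₁ (part₁ α β v) xor χ₂ (part₂ α β v)) xor τ) →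
               HasComponents ψ (2 * N₁ * N₂)
  components {τ = τ} ψ≡ =
    transport (splitting α β) (Adj-split α β) (Adj-merge α β) ψ≡
      (relabel labelCode (□-components (colourComponents C₁ C₁ᶜ) (colourComponents C₂ C₂ᶜ) τ))
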